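{- If $\mathbf A \in \mathcal A_3 \cup \mathcal A_5 \cup \mathcal A_7 \cup \mathcal A_8 \cup \mathcal A_{10}$, then $\mathbf A$ satisfies (1) $(x \to y)' \approx x \to (0 \to y)$, (2) $x' \to y \approx x \to y'$, and (3) $0 \to (x \to y) \approx 0 \to (y \to x)$.
   Context: An $\mathcal I$-zroupoid is an algebra $\langle A,\to,0\rangle$ ($\to$ binary, $0$ constant) satisfying $(x \to y) \to z \approx [(z' \to x) \to (y \to z)']'$ and $0''\approx 0$, where $x' := x \to 0$ (prime binds tighter than $\to$); $\mathcal I$ is their variety. $\mathcal A_3, \mathcal A_5, \mathcal A_7, \mathcal A_8, \mathcal A_{10}$ are the subvarieties of $\mathcal I$ defined respectively by (A3) $x \to (y \to z) \approx (x \to z) \to y$; (A5) $x \to (y \to z) \approx (y \to x) \to z$; (A7) $x \to (y \to z) \approx (y \to z) \to x$; (A8) $x \to (y \to z) \approx (z \to x) \to y$; (A10) $x \to (y \to z) \approx (z \to y) \to x$. -}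

module Defs where

open import Level using (Level; suc)
open import Relation.Binary.PropositionalEquality using (_≡_)
open import Data.Sum using (_⊎_)

record Zroupoid (ℓ : Level) : Set (suc ℓ) where
  infixr 5 _⇒_
  field
    Carrier : Set ℓ
    _⇒_     : Carrier → Carrier → Carrier
    𝟎       : Carrier

  _′ : Carrier → Carrier
  x ′ = x ⇒ 𝟎

IsIZroupoid : ∀ {ℓ} → Zroupoid ℓ → Set ℓ
IsIZroupoid A = (∀ x y z → (x ⇒ y) ⇒ z ≡ (((z ′) ⇒ x) ⇒ ((y ⇒ z) ′)) ′)
              × ((𝟎 ′) ′ ≡ 𝟎)
  where open Zroupoid A
        open import Data.Product using (_×_)

module _ {ℓ} (A : Zroupoid ℓ) where
  open Zroupoid A

  A3 : Set ℓ
  A3 = ∀ x y z → x ⇒ (y ⇒ z) ≡ (x ⇒ z) ⇒ y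
  A5 : Set ℓ
  A5 = ∀ x y z → x ⇒ (y ⇒ z) ≡ (y ⇒ x) ⇒ z
  A7 : Set ℓ
  A7 = ∀ x y z → x ⇒ (y ⇒ z) ≡ (y ⇒ z) ⇒ x
  A8 : Set ℓ
  A8 = ∀ x y z → x ⇒ (y ⇒ z) ≡ (z ⇒ x) ⇒ y
  A10 : Set ℓ
  A10 = ∀ x y z → x ⇒ (y ⇒ z) ≡ (z ⇒ y) ⇒ x

  InUnion : Set ℓ
  InUnion = A3 ⊎ A5 ⊎ A7 ⊎ A8 ⊎ A10

-- Specialising any of the five identities to x = y = z = 0 gives 0 ⇒ 0′ = 0′′ = 0, and in an
-- 𝓘-zroupoid this already forces 0′ = 0.  Each identity then yields 0 ⇒ x = x′: in 𝓐3 and 𝓐8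
-- because there ′′ fixes every prime, in 𝓐5 because 0 ⇒ u′ = u′′ and 0′ ⇒ x is a prime, and in
-- 𝓐7 and 𝓐10 because 0′ commutes with everything.  With 0 ⇒ x = x′ the identities of 𝓐3, 𝓐5
-- and 𝓐8 give (1)–(3) by direct rewriting.  In 𝓐7 and 𝓐10 every prime commutes with everything;
-- together with the defining identity at z = 0, which reads (x ⇒ y)′ = (x′ ⇒ y′′)′, this makes
-- ′′ fix every prime, so (x ⇒ y)′ = (x′ ⇒ y′)′ is symmetric in x and y and equals x ⇒ y′.

module Submission where

open import Defs
open import Level using (Level)
open import Data.Product using (_×_; _,_; proj₁; proj₂)
open import Data.Sum using (inj₁; inj₂)
open import Relation.Binary.PropositionalEquality using (_≡_; sym; trans; cong; module ≡-Reasoning)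

module IZroupoidProperties {ℓ} (A : Zroupoid ℓ) (isI : IsIZroupoid A) where
  open Zroupoid A
  open ≡-Reasoning

  Lemma3p11Identities : Set ℓ
  Lemma3p11Identities =
    (∀ x y → (x ⇒ y) ′ ≡ x ⇒ (𝟎 ⇒ y))
    × (∀ x y → x ′ ⇒ y ≡ x ⇒ y ′)
    × (∀ x y → 𝟎 ⇒ (x ⇒ y) ≡ 𝟎 ⇒ (y ⇒ x))

  defining-identity : ∀ x y z → (x ⇒ y) ⇒ z ≡ ((z ′ ⇒ x) ⇒ (y ⇒ z) ′) ′
  defining-identity = proj₁ isI

  𝟎′′≡𝟎 : 𝟎 ′ ′ ≡ 𝟎
  𝟎′′≡𝟎 = proj₂ isI

  -- With u := 0 ⇒ 0′ = 0, the instance at (0′, 0, 0′) of the defining identity reads u = (u ⇒ u′)′.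
  𝟎⇒𝟎′≡𝟎′′⇒𝟎′≡𝟎 : 𝟎 ⇒ 𝟎 ′ ≡ 𝟎 ′ ′ → 𝟎 ′ ≡ 𝟎
  𝟎⇒𝟎′≡𝟎′′⇒𝟎′≡𝟎 h = begin
    𝟎 ′                                       ≡⟨ trans (cong (λ u → (u ⇒ u ′) ′) u≡𝟎) (cong _′ u≡𝟎) ⟨
    ((𝟎 ⇒ 𝟎 ′) ⇒ (𝟎 ⇒ 𝟎 ′) ′) ′               ≡⟨ cong (λ v → ((v ⇒ 𝟎 ′) ⇒ (𝟎 ⇒ 𝟎 ′) ′) ′) 𝟎′′≡𝟎 ⟨
    ((𝟎 ′ ′ ⇒ 𝟎 ′) ⇒ (𝟎 ⇒ 𝟎 ′) ′) ′           ≡⟨ defining-identity (𝟎 ′) 𝟎 (𝟎 ′) ⟨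
    𝟎 ′ ′ ⇒ 𝟎 ′                               ≡⟨ cong (_⇒ 𝟎 ′) 𝟎′′≡𝟎 ⟩
    𝟎 ⇒ 𝟎 ′                                   ≡⟨ u≡𝟎 ⟩
    𝟎                                         ∎
    where
    u≡𝟎 : 𝟎 ⇒ 𝟎 ′ ≡ 𝟎
    u≡𝟎 = trans h 𝟎′′≡𝟎

  𝟎′⇒x≡[x′′⇒[𝟎⇒x]′]′ : ∀ x → 𝟎 ′ ⇒ x ≡ (x ′ ′ ⇒ (𝟎 ⇒ x) ′) ′
  𝟎′⇒x≡[x′′⇒[𝟎⇒x]′]′ = defining-identity 𝟎 𝟎

  [𝟎′⇒x]′′≡x′′ : ∀ x → (𝟎 ′ ⇒ x) ′ ′ ≡ x ′ ′
  [𝟎′⇒x]′′≡x′′ x = begin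
    (𝟎 ′ ⇒ x) ′ ′                 ≡⟨ cong (λ v → ((𝟎 ′ ⇒ x) ⇒ v) ′) 𝟎′′≡𝟎 ⟨
    ((𝟎 ′ ⇒ x) ⇒ 𝟎 ′ ′) ′         ≡⟨ defining-identity x 𝟎 𝟎 ⟨
    x ′ ′                         ∎

  [[x⇒y]⇒z]′≡[x⇒y]⇒z : (∀ x → x ′ ′ ≡ x ′) → ∀ x y z → ((x ⇒ y) ⇒ z) ′ ≡ (x ⇒ y) ⇒ z
  [[x⇒y]⇒z]′≡[x⇒y]⇒z x′′≡x′ x y z = begin
    ((x ⇒ y) ⇒ z) ′       ≡⟨ cong _′ (defining-identity x y z) ⟩
    w ′ ′                 ≡⟨ x′′≡x′ w ⟩
    w ′                   ≡⟨ defining-identity x y z ⟨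
    (x ⇒ y) ⇒ z           ∎
    where
    w : Carrier
    w = (z ′ ⇒ x) ⇒ (y ⇒ z) ′

  module _ (𝟎′≡𝟎 : 𝟎 ′ ≡ 𝟎) where

    -- 0′ ⇒ x is itself a prime, so ′′ fixes it, and (0′ ⇒ x)′′ = x′′ in every 𝓘-zroupoid.
    𝟎⇒x≡x′-if-x′′≡x′ : (∀ x → x ′ ′ ≡ x ′) → ∀ x → 𝟎 ⇒ x ≡ x ′
    𝟎⇒x≡x′-if-x′′≡x′ x′′≡x′ x = begin
      𝟎 ⇒ x                 ≡⟨ cong (_⇒ x) 𝟎′≡𝟎 ⟨
      𝟎 ′ ⇒ x               ≡⟨ 𝟎′⇒x≡[x′′⇒[𝟎⇒x]′]′ x ⟩
      w ′                   ≡⟨ trans (x′′≡x′ (w ′)) (x′′≡x′ w) ⟨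
      w ′ ′ ′               ≡⟨ cong (λ v → v ′ ′) (𝟎′⇒x≡[x′′⇒[𝟎⇒x]′]′ x) ⟨
      (𝟎 ′ ⇒ x) ′ ′         ≡⟨ [𝟎′⇒x]′′≡x′′ x ⟩
      x ′ ′                 ≡⟨ x′′≡x′ x ⟩
      x ′                   ∎
      where
      w : Carrier
      w = x ′ ′ ⇒ (𝟎 ⇒ x) ′

    𝟎⇒x≡x′-if-x⇒𝟎′≡𝟎′⇒x : (∀ x → x ⇒ 𝟎 ′ ≡ 𝟎 ′ ⇒ x) → ∀ x → 𝟎 ⇒ x ≡ x ′
    𝟎⇒x≡x′-if-x⇒𝟎′≡𝟎′⇒x x⇒𝟎′≡𝟎′⇒x x = begin
      𝟎 ⇒ x         ≡⟨ cong (_⇒ x) 𝟎′≡𝟎 ⟨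
      𝟎 ′ ⇒ x       ≡⟨ x⇒𝟎′≡𝟎′⇒x x ⟨
      x ⇒ 𝟎 ′       ≡⟨ cong (x ⇒_) 𝟎′≡𝟎 ⟩
      x ′           ∎

    module _ (𝟎⇒x≡x′ : ∀ x → 𝟎 ⇒ x ≡ x ′) where

      𝟎′⇒x≡x′ : ∀ x → 𝟎 ′ ⇒ x ≡ x ′
      𝟎′⇒x≡x′ x = trans (cong (_⇒ x) 𝟎′≡𝟎) (𝟎⇒x≡x′ x)

      [x⇒y]′≡[x′⇒y′′]′ : ∀ x y → (x ⇒ y) ′ ≡ (x ′ ⇒ y ′ ′) ′
      [x⇒y]′≡[x′⇒y′′]′ x y = begin
        (x ⇒ y) ′                 ≡⟨ defining-identity x y 𝟎 ⟩
        ((𝟎 ′ ⇒ x) ⇒ y ′ ′) ′     ≡⟨ cong (λ v → (v ⇒ y ′ ′) ′) (𝟎′⇒x≡x′ x) ⟩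
        (x ′ ⇒ y ′ ′) ′           ∎

      x′≡[x′′⇒x′′]′ : ∀ x → x ′ ≡ (x ′ ′ ⇒ x ′ ′) ′
      x′≡[x′′⇒x′′]′ x = begin
        x ′                         ≡⟨ 𝟎′⇒x≡x′ x ⟨
        𝟎 ′ ⇒ x                     ≡⟨ 𝟎′⇒x≡[x′′⇒[𝟎⇒x]′]′ x ⟩
        (x ′ ′ ⇒ (𝟎 ⇒ x) ′) ′       ≡⟨ cong (λ v → (x ′ ′ ⇒ v ′) ′) (𝟎⇒x≡x′ x) ⟩
        (x ′ ′ ⇒ x ′ ′) ′           ∎

      x′′′′≡x′′ : ∀ x → x ′ ′ ′ ′ ≡ x ′ ′
      x′′′′≡x′′ x = begin
        x ′ ′ ′ ′                   ≡⟨ cong _′ (𝟎′⇒x≡x′ (x ′ ′)) ⟨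
        (𝟎 ′ ⇒ x ′ ′) ′             ≡⟨ [x⇒y]′≡[x′⇒y′′]′ 𝟎 x ⟨
        (𝟎 ⇒ x) ′                   ≡⟨ cong _′ (𝟎⇒x≡x′ x) ⟩
        x ′ ′                       ∎

      module _ (x′′≡x′ : ∀ x → x ′ ′ ≡ x ′) where

        [x⇒y]′≡[x′⇒y′]′ : ∀ x y → (x ⇒ y) ′ ≡ (x ′ ⇒ y ′) ′
        [x⇒y]′≡[x′⇒y′]′ x y = trans ([x⇒y]′≡[x′⇒y′′]′ x y) (cong (λ v → (x ′ ⇒ v) ′) (x′′≡x′ y))

        [x⇒y]′≡[x⇒y′]′ : ∀ x y → (x ⇒ y) ′ ≡ (x ⇒ y ′) ′
        [x⇒y]′≡[x⇒y′]′ x y = begin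
          (x ⇒ y) ′             ≡⟨ [x⇒y]′≡[x′⇒y′′]′ x y ⟩
          (x ′ ⇒ y ′ ′) ′       ≡⟨ [x⇒y]′≡[x′⇒y′]′ x (y ′) ⟨
          (x ⇒ y ′) ′           ∎

      module _ (x⇒y′≡y′⇒x : ∀ x y → x ⇒ y ′ ≡ y ′ ⇒ x) where

        x′′≡x′-if-primes-commute : ∀ x → x ′ ′ ≡ x ′
        x′′≡x′-if-primes-commute x = begin
          x ′ ′                       ≡⟨ x′≡[x′′⇒x′′]′ (x ′) ⟩
          (x ′ ′ ′ ⇒ x ′ ′ ′) ′       ≡⟨ [x⇒y]′≡[x′⇒y′′]′ (x ′ ′) (x ′) ⟨
          (x ′ ′ ⇒ x ′) ′             ≡⟨ cong _′ (x⇒y′≡y′⇒x (x ′ ′) x) ⟩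
          (x ′ ⇒ x ′ ′) ′             ≡⟨ [x⇒y]′≡[x′⇒y′′]′ (x ′) (x ′ ′) ⟩
          (x ′ ′ ⇒ x ′ ′ ′ ′) ′       ≡⟨ cong (λ v → (x ′ ′ ⇒ v) ′) (x′′′′≡x′′ x) ⟩
          (x ′ ′ ⇒ x ′ ′) ′           ≡⟨ x′≡[x′′⇒x′′]′ x ⟨
          x ′                         ∎

        [x⇒y]′≡x⇒y′ : ∀ x y → (x ⇒ y) ′ ≡ x ⇒ y ′
        [x⇒y]′≡x⇒y′ x y = begin
          (x ⇒ y) ′           ≡⟨ [x⇒y]′≡[x⇒y′]′ x′′≡x′-if-primes-commute x y ⟩
          (x ⇒ y ′) ′         ≡⟨ cong _′ (x⇒y′≡y′⇒x x y) ⟩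
          (y ′ ⇒ x) ′         ≡⟨ [[x⇒y]⇒z]′≡[x⇒y]⇒z x′′≡x′-if-primes-commute y 𝟎 x ⟩
          y ′ ⇒ x             ≡⟨ x⇒y′≡y′⇒x x y ⟨
          x ⇒ y ′             ∎

        [x⇒y]′≡[y⇒x]′ : ∀ x y → (x ⇒ y) ′ ≡ (y ⇒ x) ′
        [x⇒y]′≡[y⇒x]′ x y = begin
          (x ⇒ y) ′           ≡⟨ [x⇒y]′≡[x′⇒y′]′ x′′≡x′-if-primes-commute x y ⟩
          (x ′ ⇒ y ′) ′       ≡⟨ cong _′ (x⇒y′≡y′⇒x (x ′) y) ⟩
          (y ′ ⇒ x ′) ′       ≡⟨ [x⇒y]′≡[x′⇒y′]′ x′′≡x′-if-primes-commute y x ⟨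
          (y ⇒ x) ′           ∎

        identities-if-primes-commute : Lemma3p11Identities
        identities-if-primes-commute =
          (λ x y → trans ([x⇒y]′≡x⇒y′ x y) (cong (x ⇒_) (sym (𝟎⇒x≡x′ y))))
          , (λ x y → begin
              x ′ ⇒ y           ≡⟨ x⇒y′≡y′⇒x y x ⟨
              y ⇒ x ′           ≡⟨ [x⇒y]′≡x⇒y′ y x ⟨
              (y ⇒ x) ′         ≡⟨ [x⇒y]′≡[y⇒x]′ y x ⟩
              (x ⇒ y) ′         ≡⟨ [x⇒y]′≡x⇒y′ x y ⟩
              x ⇒ y ′           ∎)
          , (λ x y → begin
              𝟎 ⇒ (x ⇒ y)       ≡⟨ 𝟎⇒x≡x′ (x ⇒ y) ⟩
              (x ⇒ y) ′         ≡⟨ [x⇒y]′≡[y⇒x]′ x y ⟩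
              (y ⇒ x) ′         ≡⟨ 𝟎⇒x≡x′ (y ⇒ x) ⟨
              𝟎 ⇒ (y ⇒ x)       ∎)

  module InA3 (a3 : A3 A) where

    𝟎′≡𝟎 : 𝟎 ′ ≡ 𝟎
    𝟎′≡𝟎 = 𝟎⇒𝟎′≡𝟎′′⇒𝟎′≡𝟎 (a3 𝟎 𝟎 𝟎)

    x′′≡x′ : ∀ x → x ′ ′ ≡ x ′
    x′′≡x′ x = trans (sym (a3 x 𝟎 𝟎)) (cong (x ⇒_) 𝟎′≡𝟎)

    𝟎⇒x≡x′ : ∀ x → 𝟎 ⇒ x ≡ x ′
    𝟎⇒x≡x′ = 𝟎⇒x≡x′-if-x′′≡x′ 𝟎′≡𝟎 x′′≡x′

    𝟎⇒-comm : ∀ x y → 𝟎 ⇒ (x ⇒ y) ≡ 𝟎 ⇒ (y ⇒ x)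
    𝟎⇒-comm x y = begin
      𝟎 ⇒ (x ⇒ y)     ≡⟨ 𝟎⇒x≡x′ (x ⇒ y) ⟩
      (x ⇒ y) ′       ≡⟨ a3 x 𝟎 y ⟨
      x ⇒ (𝟎 ⇒ y)     ≡⟨ cong (x ⇒_) (𝟎⇒x≡x′ y) ⟩
      x ⇒ y ′         ≡⟨ a3 x y 𝟎 ⟩
      x ′ ⇒ y         ≡⟨ cong (_⇒ y) (𝟎⇒x≡x′ x) ⟨
      (𝟎 ⇒ x) ⇒ y     ≡⟨ a3 𝟎 y x ⟨
      𝟎 ⇒ (y ⇒ x)     ∎

    identities : Lemma3p11Identities
    identities = (λ x y → sym (a3 x 𝟎 y)) , (λ x y → sym (a3 x y 𝟎)) , 𝟎⇒-comm

  module InA5 (a5 : A5 A) where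

    𝟎⇒x≡x′ : ∀ x → 𝟎 ⇒ x ≡ x ′
    𝟎⇒x≡x′ x = begin
      𝟎 ⇒ x                 ≡⟨ cong (_⇒ x) 𝟎′′≡𝟎 ⟨
      𝟎 ′ ′ ⇒ x             ≡⟨ a5 𝟎 (𝟎 ′) x ⟨
      𝟎 ⇒ (𝟎 ′ ⇒ x)         ≡⟨ cong (𝟎 ⇒_) (𝟎′⇒x≡[x′′⇒[𝟎⇒x]′]′ x) ⟩
      𝟎 ⇒ w ′               ≡⟨ a5 𝟎 w 𝟎 ⟩
      w ′ ′                 ≡⟨ cong _′ (𝟎′⇒x≡[x′′⇒[𝟎⇒x]′]′ x) ⟨
      (𝟎 ′ ⇒ x) ′           ≡⟨ a5 x (𝟎 ′) 𝟎 ⟨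
      x ⇒ 𝟎 ′ ′             ≡⟨ cong (x ⇒_) 𝟎′′≡𝟎 ⟩
      x ′                   ∎
      where
      w : Carrier
      w = x ′ ′ ⇒ (𝟎 ⇒ x) ′

    x′⇒y≡x⇒[𝟎⇒y] : ∀ x y → x ′ ⇒ y ≡ x ⇒ (𝟎 ⇒ y)
    x′⇒y≡x⇒[𝟎⇒y] x y = trans (cong (_⇒ y) (sym (𝟎⇒x≡x′ x))) (sym (a5 x 𝟎 y))

    x′⇒y≡x⇒y′ : ∀ x y → x ′ ⇒ y ≡ x ⇒ y ′
    x′⇒y≡x⇒y′ x y = trans (x′⇒y≡x⇒[𝟎⇒y] x y) (cong (x ⇒_) (𝟎⇒x≡x′ y))

    𝟎⇒-comm : ∀ x y → 𝟎 ⇒ (x ⇒ y) ≡ 𝟎 ⇒ (y ⇒ x)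
    𝟎⇒-comm x y = begin
      𝟎 ⇒ (x ⇒ y)     ≡⟨ a5 𝟎 x y ⟩
      x ′ ⇒ y         ≡⟨ x′⇒y≡x⇒y′ x y ⟩
      x ⇒ y ′         ≡⟨ a5 x y 𝟎 ⟩
      (y ⇒ x) ′       ≡⟨ 𝟎⇒x≡x′ (y ⇒ x) ⟨
      𝟎 ⇒ (y ⇒ x)     ∎

    identities : Lemma3p11Identities
    identities =
      (λ x y → trans (sym (𝟎⇒x≡x′ (x ⇒ y))) (trans (a5 𝟎 x y) (x′⇒y≡x⇒[𝟎⇒y] x y)))
      , x′⇒y≡x⇒y′ , 𝟎⇒-comm

  module InA8 (a8 : A8 A) where

    𝟎′≡𝟎 : 𝟎 ′ ≡ 𝟎
    𝟎′≡𝟎 = 𝟎⇒𝟎′≡𝟎′′⇒𝟎′≡𝟎 (a8 𝟎 𝟎 𝟎)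

    x′≡[𝟎⇒x]′ : ∀ x → x ′ ≡ (𝟎 ⇒ x) ′
    x′≡[𝟎⇒x]′ x = trans (cong (x ⇒_) (sym 𝟎′≡𝟎)) (a8 x 𝟎 𝟎)

    𝟎⇒x′≡𝟎⇒x : ∀ x → 𝟎 ⇒ x ′ ≡ 𝟎 ⇒ x
    𝟎⇒x′≡𝟎⇒x x = trans (a8 𝟎 x 𝟎) (cong (_⇒ x) 𝟎′≡𝟎)

    x′′≡x′ : ∀ x → x ′ ′ ≡ x ′
    x′′≡x′ x = begin
      x ′ ′           ≡⟨ x′≡[𝟎⇒x]′ (x ′) ⟩
      (𝟎 ⇒ x ′) ′     ≡⟨ cong _′ (𝟎⇒x′≡𝟎⇒x x) ⟩
      (𝟎 ⇒ x) ′       ≡⟨ x′≡[𝟎⇒x]′ x ⟨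
      x ′             ∎

    𝟎⇒x≡x′ : ∀ x → 𝟎 ⇒ x ≡ x ′
    𝟎⇒x≡x′ = 𝟎⇒x≡x′-if-x′′≡x′ 𝟎′≡𝟎 x′′≡x′

    𝟎⇒-comm : ∀ x y → 𝟎 ⇒ (x ⇒ y) ≡ 𝟎 ⇒ (y ⇒ x)
    𝟎⇒-comm x y = begin
      𝟎 ⇒ (x ⇒ y)           ≡⟨ a8 𝟎 x y ⟩
      y ′ ⇒ x               ≡⟨ cong (_⇒ x) (x′≡[𝟎⇒x]′ y) ⟩
      (𝟎 ⇒ y) ′ ⇒ x         ≡⟨ a8 𝟎 x (𝟎 ⇒ y) ⟨
      𝟎 ⇒ (x ⇒ (𝟎 ⇒ y))     ≡⟨ cong (𝟎 ⇒_) (a8 x 𝟎 y) ⟩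
      𝟎 ⇒ (y ⇒ x) ′         ≡⟨ 𝟎⇒x′≡𝟎⇒x (y ⇒ x) ⟩
      𝟎 ⇒ (y ⇒ x)           ∎

    identities : Lemma3p11Identities
    identities =
      (λ x y → begin
        (x ⇒ y) ′         ≡⟨ 𝟎⇒x≡x′ (x ⇒ y) ⟨
        𝟎 ⇒ (x ⇒ y)       ≡⟨ 𝟎⇒-comm x y ⟩
        𝟎 ⇒ (y ⇒ x)       ≡⟨ 𝟎⇒x≡x′ (y ⇒ x) ⟩
        (y ⇒ x) ′         ≡⟨ a8 x 𝟎 y ⟨
        x ⇒ (𝟎 ⇒ y)       ∎)
      , (λ x y → trans (cong (_⇒ y) (sym (𝟎⇒x≡x′ x))) (sym (a8 x y 𝟎)))
      , 𝟎⇒-comm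

  module InA7 (a7 : A7 A) where

    𝟎′≡𝟎 : 𝟎 ′ ≡ 𝟎
    𝟎′≡𝟎 = 𝟎⇒𝟎′≡𝟎′′⇒𝟎′≡𝟎 (a7 𝟎 𝟎 𝟎)

    𝟎⇒x≡x′ : ∀ x → 𝟎 ⇒ x ≡ x ′
    𝟎⇒x≡x′ = 𝟎⇒x≡x′-if-x⇒𝟎′≡𝟎′⇒x 𝟎′≡𝟎 (λ x → a7 x 𝟎 𝟎)

    x⇒y′≡y′⇒x : ∀ x y → x ⇒ y ′ ≡ y ′ ⇒ x
    x⇒y′≡y′⇒x x y = a7 x y 𝟎

    identities : Lemma3p11Identities
    identities = identities-if-primes-commute 𝟎′≡𝟎 𝟎⇒x≡x′ x⇒y′≡y′⇒x

  module InA10 (a10 : A10 A) where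

    𝟎′≡𝟎 : 𝟎 ′ ≡ 𝟎
    𝟎′≡𝟎 = 𝟎⇒𝟎′≡𝟎′′⇒𝟎′≡𝟎 (a10 𝟎 𝟎 𝟎)

    𝟎⇒x≡x′ : ∀ x → 𝟎 ⇒ x ≡ x ′
    𝟎⇒x≡x′ = 𝟎⇒x≡x′-if-x⇒𝟎′≡𝟎′⇒x 𝟎′≡𝟎 (λ x → a10 x 𝟎 𝟎)

    x⇒y′≡y′⇒x : ∀ x y → x ⇒ y ′ ≡ y ′ ⇒ x
    x⇒y′≡y′⇒x x y = trans (a10 x y 𝟎) (cong (_⇒ x) (𝟎⇒x≡x′ y))

    identities : Lemma3p11Identities
    identities = identities-if-primes-commute 𝟎′≡𝟎 𝟎⇒x≡x′ x⇒y′≡y′⇒x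

lemma3p11 : ∀ {ℓ : Level} (A : Zroupoid ℓ) → IsIZroupoid A → InUnion A →
    let open Zroupoid A in
    (∀ x y → (x ⇒ y) ′ ≡ x ⇒ (𝟎 ⇒ y))
    × (∀ x y → (x ′) ⇒ y ≡ x ⇒ (y ′))
    × (∀ x y → 𝟎 ⇒ (x ⇒ y) ≡ 𝟎 ⇒ (y ⇒ x))
lemma3p11 A isI (inj₁ a3) = IZroupoidProperties.InA3.identities A isI a3
lemma3p11 A isI (inj₂ (inj₁ a5)) = IZroupoidProperties.InA5.identities A isI a5
lemma3p11 A isI (inj₂ (inj₂ (inj₁ a7))) = IZroupoidProperties.InA7.identities A isI a7
lemma3p11 A isI (inj₂ (inj₂ (inj₂ (inj₁ a8)))) = IZroupoidProperties.InA8.identities A isI a8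
lemma3p11 A isI (inj₂ (inj₂ (inj₂ (inj₂ a10)))) = IZroupoidProperties.InA10.identities A isI a10
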